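{- Let $\mathbf V$ be a commutative unital quantale, let $\mathbf H_1=(\mathbf A_1,F_1)$, $\mathbf H_2=(\mathbf A_2,F_2)$ be $\mathbf V$-F-semilattices, $f\colon\mathbf H_1\to\mathbf H_2$ a lax morphism, and $\mathbf J=(T,r)$ a $\mathbf V$-frame. Then there is a unique $\mathbf V$-module homomorphism $\mathbf J\otimes f\colon\mathbf J\otimes\mathbf H_1\to\mathbf J\otimes\mathbf H_2$ such that $\mathrm n(j[\mathbf J,\mathbf H_2])\circ f^{\mathbf J}=(\mathbf J\otimes f)\circ\mathrm n(j[\mathbf J,\mathbf H_1])$, where $f^{\mathbf J}\colon A_1^T\to A_2^T$, $(f^{\mathbf J}(x))(i)=f(x(i))$. Moreover, $\mathbf J\otimes-$ is a functor from $\mathbf V$-F-$\mathbb S_\le$ to $\mathbf V$-$\mathbb S$.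
   Context: A commutative unital quantale $\mathbf V=(V,\bigvee,\otimes,e)$: complete lattice, commutative monoid, $\otimes$ distributing over arbitrary joins. A $\mathbf V$-module $(A,\bigvee,*)$: complete lattice with $*\colon V\times A\to A$ preserving joins in each argument, $u*(v*a)=(u\otimes v)*a$, $e*a=a$; module homomorphisms preserve arbitrary joins and the action; $\mathbf V$-$\mathbb S$ is their category. A $\mathbf V$-frame is $(T,r)$ with $r\colon T\times T\to V$. A $\mathbf V$-F-semilattice is $(\mathbf A,F)$ with $F$ a module endomorphism; a lax morphism $f\colon(\mathbf A_1,F_1)\to(\mathbf A_2,F_2)$ is a module homomorphism with $F_2(f(a))\le f(F_1(a))$; $\mathbf V$-F-$\mathbb S_\le$ is this category. Prenuclei on a module $\mathbf M$: $j\colon M\to M$ with $a\le j(a)$, monotone, $v*j(a)\le j(v*a)$; $M_j=\{a\mid j(a)=a\}$; $\mathrm n(j)(a)=\bigwedge\{x\in M_j\mid a\le x\}$; for a nucleus (idempotent prenucleus) $k$, $M_k$ is a module with joins $k(\bigvee S)$ and action $k(v*m)$. For $X\subseteq M\times M$, $j[X](a)=a\vee\bigvee\{c\mid\exists d\le a:(c,d)\in X\text{ or }(d,c)\in X\}$. Tensor: for $\mathbf H=(\mathbf A,F)$, $x\in A$, $i\in T$: $x_{ir}(j)=r(i,j)*x$, and $x_{i=}(i)=x$, $x_{i=}(j)=0$ for $j\ne i$ (elements of $A^T$). $[\mathbf J,\mathbf H]=\{(x_{ir}\vee F(x)_{i=},F(x)_{i=})\mid x\in A,i\in T\}$, $j[\mathbf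 J,\mathbf H]=j[[\mathbf J,\mathbf H]]$ in the pointwise module $\mathbf A^T$, $\mathbf J\otimes\mathbf H=(\mathbf A^T)_{\mathrm n(j[\mathbf J,\mathbf H])}$, with $\mathrm n(j[\mathbf J,\mathbf H])$ regarded as a map $A^T\to\mathbf J\otimes\mathbf H$. -}

module Defs where

open import Level using (Level; Lift; lift; lower) renaming (suc to lsuc)
open import Data.Bool using (Bool; true; false)
open import Data.Product using (Σ; _×_; _,_; proj₁; proj₂)
open import Data.Sum using (_⊎_; inj₁; inj₂)
open import Relation.Binary.PropositionalEquality using (_≡_)

-- Joins are taken over arbitrary
-- families indexed by types of the ambient level ℓ; equality of
-- elements is the antisymmetry equivalence  a ≈ b  :=  a ≤ b × b ≤ a.

record RawCLat (ℓ : Level) : Set (lsuc ℓ) where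
  field
    Carrier : Set ℓ
    _≤_     : Carrier → Carrier → Set ℓ
    ⋁       : {I : Set ℓ} → (I → Carrier) → Carrier

  infix 4 _≈_
  _≈_ : Carrier → Carrier → Set ℓ
  a ≈ b = (a ≤ b) × (b ≤ a)

  _∨_ : Carrier → Carrier → Carrier
  a ∨ b = ⋁ {Lift ℓ Bool} (λ { (lift true) → a ; (lift false) → b })

  ⋀ : {I : Set ℓ} → (I → Carrier) → Carrier
  ⋀ {I} f = ⋁ {Σ Carrier (λ y → (i : I) → y ≤ f i)} proj₁

record IsCLat {ℓ : Level} (L : RawCLat ℓ) : Set (lsuc ℓ) where
  open RawCLat L
  field
    ≤-refl  : ∀ {a} → a ≤ a
    ≤-trans : ∀ {a b c} → a ≤ b → b ≤ c → a ≤ c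
    ⋁-ub    : ∀ {I : Set ℓ} (f : I → Carrier) (i : I) → f i ≤ ⋁ f
    ⋁-least : ∀ {I : Set ℓ} (f : I → Carrier) {b : Carrier} →
              ((i : I) → f i ≤ b) → ⋁ f ≤ b

record Quantale (ℓ : Level) : Set (lsuc ℓ) where
  field
    L      : RawCLat ℓ
    isCLat : IsCLat L
  open RawCLat L public
  field
    _⊗_       : Carrier → Carrier → Carrier
    e         : Carrier
    ⊗-cong    : ∀ {a a' b b'} → a ≈ a' → b ≈ b' → (a ⊗ b) ≈ (a' ⊗ b')
    ⊗-assoc   : ∀ a b c → ((a ⊗ b) ⊗ c) ≈ (a ⊗ (b ⊗ c))
    ⊗-comm    : ∀ a b → (a ⊗ b) ≈ (b ⊗ a)
    ⊗-unitˡ   : ∀ a → (e ⊗ a) ≈ a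
    ⊗-unitʳ   : ∀ a → (a ⊗ e) ≈ a
    ⊗-⋁ʳ      : ∀ a {I : Set ℓ} (f : I → Carrier) →
                (a ⊗ ⋁ f) ≈ ⋁ (λ i → a ⊗ f i)
    ⊗-⋁ˡ      : ∀ {I : Set ℓ} (f : I → Carrier) a →
                (⋁ f ⊗ a) ≈ ⋁ (λ i → f i ⊗ a)

module _ {ℓ : Level} (V : Quantale ℓ) where
  private
    module V = Quantale V

  record RawModule : Set (lsuc ℓ) where
    field
      L   : RawCLat ℓ
    open RawCLat L public
    field
      _*_ : V.Carrier → Carrier → Carrier

  record IsModule (M : RawModule) : Set (lsuc ℓ) where
    open RawModule M
    field
      isCLat  : IsCLat L
      *-cong  : ∀ {u v a b} → u V.≈ v → a ≈ b → (u * a) ≈ (v * b)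
      *-⋁ˡ    : ∀ {I : Set ℓ} (f : I → V.Carrier) a →
                (V.⋁ f * a) ≈ ⋁ (λ i → f i * a)
      *-⋁ʳ    : ∀ v {I : Set ℓ} (f : I → Carrier) →
                (v * ⋁ f) ≈ ⋁ (λ i → v * f i)
      *-assoc : ∀ u v a → (u * (v * a)) ≈ ((u V.⊗ v) * a)
      *-unit  : ∀ a → (V.e * a) ≈ a

  record Module : Set (lsuc ℓ) where
    field
      raw      : RawModule
      isModule : IsModule raw
    open RawModule raw public
    open IsModule isModule public
    open IsCLat isCLat public

  -- module homomorphisms: preserve arbitrary joins and the action
  -- (and respect equality, as every function does set-theoretically)
  record IsHom (M N : RawModule) (h : RawModule.Carrier M → RawModule.Carrier N)
         : Set (lsuc ℓ) where
    private
      module M = RawModule M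
      module N = RawModule N
    field
      cong : ∀ {a b} → a M.≈ b → h a N.≈ h b
      pres-⋁ : ∀ {I : Set ℓ} (f : I → M.Carrier) → h (M.⋁ f) N.≈ N.⋁ (λ i → h (f i))
      pres-* : ∀ v a → h (v M.* a) N.≈ (v N.* h a)

  record Frame : Set (lsuc ℓ) where
    field
      T : Set ℓ
      r : T → T → V.Carrier

  record FSL : Set (lsuc ℓ) where
    field
      A     : Module
    open Module A public
    field
      F     : Carrier → Carrier
      F-hom : IsHom raw raw F

  record Lax (H₁ H₂ : FSL) : Set (lsuc ℓ) where
    private
      module H₁ = FSL H₁
      module H₂ = FSL H₂
    field
      fun : H₁.Carrier → H₂.Carrier
      hom : IsHom H₁.raw H₂.raw fun
      lax : ∀ a → H₂.F (fun a) H₂.≤ fun (H₁.F a)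

module _ {ℓ : Level} (M : RawCLat ℓ) where
  open RawCLat M

  jRel : (Carrier → Carrier → Set ℓ) → Carrier → Carrier
  jRel X a = a ∨ ⋁ {Σ Carrier (λ c → Σ Carrier (λ d → (X c d ⊎ X d c) × (d ≤ a)))} proj₁

  nucl : (Carrier → Carrier) → Carrier → Carrier
  nucl j a = ⋀ {Σ Carrier (λ x → (j x ≈ x) × (a ≤ x))} proj₁

module _ {ℓ : Level} {M : RawCLat ℓ} (isL : IsCLat M) where
  open RawCLat M
  open IsCLat isL

  jRel-infl : ∀ X a → a ≤ jRel M X a
  jRel-infl X a = ⋁-ub _ (lift true)

  jRel-mono : ∀ X {a b} → a ≤ b → jRel M X a ≤ jRel M X b
  jRel-mono X {a} {b} a≤b = ⋁-least _ λ
    { (lift true)  → ≤-trans a≤b (jRel-infl X b)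
    ; (lift false) → ⋁-least _ (λ { (c , d , x , d≤a) →
        ≤-trans (⋁-ub {I = Σ Carrier (λ c → Σ Carrier (λ d → (X c d ⊎ X d c) × (d ≤ b)))}
                      proj₁ (c , d , x , ≤-trans d≤a a≤b))
                (⋁-ub _ (lift false)) }) }

  module _ (j : Carrier → Carrier)
           (infl : ∀ a → a ≤ j a) (mono : ∀ {a b} → a ≤ b → j a ≤ j b) where

    nucl-infl : ∀ a → a ≤ nucl M j a
    nucl-infl a = ⋁-ub _ (a , λ s → proj₂ (proj₂ s))

    nucl-below : ∀ a (s : Σ Carrier (λ x → (j x ≈ x) × (a ≤ x))) → nucl M j a ≤ proj₁ s
    nucl-below a s = ⋁-least _ (λ y → proj₂ y s)

    nucl-fix : ∀ a → j (nucl M j a) ≈ nucl M j a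
    nucl-fix a = ⋁-ub _ (j (nucl M j a) , λ s →
                   ≤-trans (mono (nucl-below a s)) (proj₁ (proj₁ (proj₂ s))))
               , infl _

    nucl-idem : ∀ a → nucl M j (nucl M j a) ≈ nucl M j a
    nucl-idem a = nucl-below (nucl M j a) (nucl M j a , nucl-fix a , ≤-refl)
                , nucl-infl (nucl M j a)

module _ {ℓ : Level} {V : Quantale ℓ} (J : Frame V) where
  private
    module V = Quantale V
  open Frame J

  module _ (A : Module V) where
    private
      module A = Module A

    PowL : RawCLat ℓ
    PowL = record
      { Carrier = T → A.Carrier
      ; _≤_     = λ x y → (t : T) → x t A.≤ y t
      ; ⋁       = λ f t → A.⋁ (λ i → f i t)
      }

    PowRaw : RawModule V
    PowRaw = record { L = PowL ; _*_ = λ v x t → v A.* x t }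

    Pow-isCLat : IsCLat PowL
    Pow-isCLat = record
      { ≤-refl  = λ t → A.≤-refl
      ; ≤-trans = λ p q t → A.≤-trans (p t) (q t)
      ; ⋁-ub    = λ f i t → A.⋁-ub (λ k → f k t) i
      ; ⋁-least = λ f p t → A.⋁-least (λ k → f k t) (λ i → p i t)
      }

    _ᵢᵣ : A.Carrier → T → (T → A.Carrier)
    (x ᵢᵣ) i t = r i t A.* x

    -- x_{i=}(i) = x, x_{i=}(j) = 0 for j ≠ i;
    -- rendered as the join of x over the proofs of  t ≡ i
    _ᵢ₌ : A.Carrier → T → (T → A.Carrier)
    (x ᵢ₌) i t = A.⋁ {t ≡ i} (λ _ → x)

  module _ (H : FSL V) where
    private
      module H = FSL H
    open RawCLat (PowL H.A) using () renaming (_∨_ to _∨ᵀ_; Carrier to Pow)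

    JH : Pow → Pow → Set ℓ
    JH p q = Σ H.Carrier (λ x → Σ T (λ i →
               (p ≡ ((_ᵢᵣ H.A x i) ∨ᵀ (_ᵢ₌ H.A (H.F x) i))) × (q ≡ _ᵢ₌ H.A (H.F x) i)))

    jJH : Pow → Pow
    jJH = jRel (PowL H.A) JH

    nJH : Pow → Pow
    nJH = nucl (PowL H.A) jJH

    nJH-idem : ∀ a → RawCLat._≈_ (PowL H.A) (nJH (nJH a)) (nJH a)
    nJH-idem = nucl-idem (Pow-isCLat H.A) jJH (jRel-infl (Pow-isCLat H.A) JH)
                 (jRel-mono (Pow-isCLat H.A) JH)

    private
      module P = RawModule (PowRaw H.A)

    Fix : Set ℓ
    Fix = Σ Pow (λ m → nJH m P.≈ m)

    TensorL : RawCLat ℓ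
    TensorL = record
      { Carrier = Fix
      ; _≤_     = λ m n → proj₁ m P.≤ proj₁ n
      ; ⋁       = λ f → nJH (P.⋁ (λ i → proj₁ (f i))) , nJH-idem _
      }

    Tensor : RawModule V
    Tensor = record
      { L   = TensorL
      ; _*_ = λ v m → nJH (v P.* proj₁ m) , nJH-idem _
      }

    nMap : Pow → Fix
    nMap x = nJH x , nJH-idem x

  _^J : {H₁ H₂ : FSL V} → (FSL.Carrier H₁ → FSL.Carrier H₂) →
        (T → FSL.Carrier H₁) → (T → FSL.Carrier H₂)
  (φ ^J) x t = φ (x t)

  Char : (H₁ H₂ : FSL V) → (FSL.Carrier H₁ → FSL.Carrier H₂) →
         (Fix H₁ → Fix H₂) → Set (lsuc ℓ)
  Char H₁ H₂ φ g =
    IsHom V (Tensor H₁) (Tensor H₂) g ×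
    ((x : T → FSL.Carrier H₁) →
       RawModule._≈_ (Tensor H₂) (nMap H₂ ((_^J {H₁} {H₂} φ) x)) (g (nMap H₁ x)))

{-# OPTIONS --safe #-}
-- J ⊗ H is the module of fixed points of the nucleus n generated by the prenucleus
-- j[J,H] on A^T.  A join-preserving h with h ∘ j₁ ≤ j₂ ∘ h also satisfies
-- h ∘ n₁ ≤ n₂ ∘ h: the right adjoint of h carries the n₂-closed element n₂ (h a) to a
-- j₁-closed element above a.  For h = scalar multiplication this makes n a nucleus of
-- modules; for h = f^J with f lax it gives n₂ ∘ f^J ∘ n₁ = n₂ ∘ f^J, so n₂ ∘ f^J restricts
-- to a module map J ⊗ H₁ → J ⊗ H₂.  Since every element of J ⊗ H is its own n-image, a
-- module map satisfying the defining equation is determined by it, which gives uniqueness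
-- and functoriality.
module Submission where

open import Defs
open import Level using (Level; lift)
open import Data.Bool using (true; false)
open import Data.Product using (Σ; _×_; _,_; proj₁; proj₂; swap)
open import Data.Sum using (_⊎_; inj₁; inj₂)
open import Function using (_∘_)
open import Relation.Binary.PropositionalEquality using (refl)
open import Relation.Binary.Lattice using (JoinSemilattice)
import Relation.Binary.Lattice.Properties.JoinSemilattice as JoinSemilatticeProperties
import Relation.Binary.Reasoning.PartialOrder as PosetReasoning

private
  variable
    ℓ : Level

module CLatProperties {L : RawCLat ℓ} (isCLat : IsCLat L) where
  open RawCLat L
  open IsCLat isCLat

  joinSemilattice : JoinSemilattice ℓ ℓ ℓ
  joinSemilattice = record
    { Carrier = Carrier
    ; _≈_ = _≈_
    ; _≤_ = _≤_
    ; _∨_ = _∨_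
    ; isJoinSemilattice = record
      { isPartialOrder = record
        { isPreorder = record
          { isEquivalence = record
            { refl  = ≤-refl , ≤-refl
            ; sym   = λ (a≤b , b≤a) → b≤a , a≤b
            ; trans = λ (a≤b , b≤a) (b≤c , c≤b) → ≤-trans a≤b b≤c , ≤-trans c≤b b≤a
            }
          ; reflexive = proj₁
          ; trans     = ≤-trans
          }
        ; antisym = _,_
        }
      ; supremum = λ a b → ⋁-ub _ (lift true) , ⋁-ub _ (lift false) , λ c a≤c b≤c →
          ⋁-least _ λ { (lift true) → a≤c ; (lift false) → b≤c }
      }
    }

  open JoinSemilattice joinSemilattice public
    using (poset; x≤x∨y; y≤x∨y; module Eq)
  open JoinSemilatticeProperties joinSemilattice public using (x≤y⇒x∨y≈y)

  jRel-generator : ∀ {X : Carrier → Carrier → Set ℓ} {a c d} →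
                   X c d ⊎ X d c → d ≤ a → c ≤ jRel L X a
  jRel-generator {X} {a} {c} {d} cd∈X d≤a = ≤-trans
    (⋁-ub {I = Σ Carrier (λ c → Σ Carrier (λ d → (X c d ⊎ X d c) × (d ≤ a)))} proj₁
          (c , d , cd∈X , d≤a))
    (⋁-ub _ (lift false))

module _ {L₁ L₂ : RawCLat ℓ} (isCLat₁ : IsCLat L₁) (isCLat₂ : IsCLat L₂) where
  private
    module L₁ = RawCLat L₁
    module L₂ = RawCLat L₂
    module P₁ = CLatProperties isCLat₁
    module P₂ = CLatProperties isCLat₂
  open IsCLat isCLat₂

  ⋁-preserving⇒mono : (h : L₁.Carrier → L₂.Carrier) →
    (∀ {a b} → a L₁.≈ b → h a L₂.≈ h b) →
    (∀ {I : Set ℓ} (f : I → L₁.Carrier) → L₂.⋁ (h ∘ f) L₂.≤ h (L₁.⋁ f)) →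
    ∀ {a b} → a L₁.≤ b → h a L₂.≤ h b
  ⋁-preserving⇒mono h h-cong h-⋁ {a} {b} a≤b = begin
    h a          ≤⟨ ≤-trans (⋁-ub _ (lift true)) (h-⋁ _) ⟩
    h (a L₁.∨ b) ≈⟨ h-cong (P₁.x≤y⇒x∨y≈y a≤b) ⟩
    h b          ∎
    where open PosetReasoning P₂.poset

  module _ (h : L₁.Carrier → L₂.Carrier)
           (h-mono : ∀ {a b} → a L₁.≤ b → h a L₂.≤ h b)
           (h-⋁ : ∀ {I : Set ℓ} (f : I → L₁.Carrier) → h (L₁.⋁ f) L₂.≤ L₂.⋁ (h ∘ f)) where

    jRel-lax : ∀ {X₁ X₂} →
      (∀ {a c d} → X₁ c d ⊎ X₁ d c → d L₁.≤ a → h c L₂.≤ jRel L₂ X₂ (h a)) →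
      ∀ a → h (jRel L₁ X₁ a) L₂.≤ jRel L₂ X₂ (h a)
    jRel-lax {X₂ = X₂} generator-lax a = ≤-trans (h-⋁ _) (⋁-least _ λ
      { (lift true)  → jRel-infl isCLat₂ X₂ (h a)
      ; (lift false) → ≤-trans (h-⋁ _)
          (⋁-least _ λ (_ , _ , cd∈X₁ , d≤a) → generator-lax cd∈X₁ d≤a)
      })

    -- u is the right adjoint of h evaluated at y; it is a j₁-fixed point above a.
    nucl-lax : ∀ {j₁ j₂} →
      (∀ a → a L₁.≤ j₁ a) → (∀ {a b} → a L₁.≤ b → j₁ a L₁.≤ j₁ b) →
      (∀ a → a L₂.≤ j₂ a) → (∀ {a b} → a L₂.≤ b → j₂ a L₂.≤ j₂ b) →
      (∀ a → h (j₁ a) L₂.≤ j₂ (h a)) →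
      ∀ a → h (nucl L₁ j₁ a) L₂.≤ nucl L₂ j₂ (h a)
    nucl-lax {j₁} {j₂} infl₁ mono₁ infl₂ mono₂ h-j a = ≤-trans (h-mono n₁a≤u) hu≤y
      where
      y = nucl L₂ j₂ (h a)
      u = L₁.⋁ {Σ L₁.Carrier (λ b → h b L₂.≤ y)} proj₁
      hu≤y : h u L₂.≤ y
      hu≤y = ≤-trans (h-⋁ proj₁) (⋁-least _ proj₂)
      j₁u≤u : j₁ u L₁.≤ u
      j₁u≤u = IsCLat.⋁-ub isCLat₁ proj₁ (j₁ u , (begin
        h (j₁ u) ≤⟨ h-j u ⟩
        j₂ (h u) ≤⟨ mono₂ hu≤y ⟩
        j₂ y     ≤⟨ proj₁ (nucl-fix isCLat₂ j₂ infl₂ mono₂ (h a)) ⟩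
        y        ∎))
        where open PosetReasoning P₂.poset
      n₁a≤u : nucl L₁ j₁ a L₁.≤ u
      n₁a≤u = nucl-below isCLat₁ j₁ infl₁ mono₁ a
        (u , (j₁u≤u , infl₁ u) ,
         IsCLat.⋁-ub isCLat₁ proj₁ (a , nucl-infl isCLat₂ j₂ infl₂ mono₂ (h a)))

module _ {V : Quantale ℓ} where
  private
    module V = Quantale V

  module ModuleProperties (M : Module V) where
    open Module M
    open CLatProperties isCLat public

    *-monoʳ : ∀ v {a b} → a ≤ b → (v * a) ≤ (v * b)
    *-monoʳ v = ⋁-preserving⇒mono isCLat isCLat (v *_)
      (*-cong (CLatProperties.Eq.refl V.isCLat)) (λ f → proj₂ (*-⋁ʳ v f))

  module HomProperties (M N : Module V) {h : Module.Carrier M → Module.Carrier N}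
                       (hom : IsHom V (Module.raw M) (Module.raw N) h) where
    private
      module M = Module M
      module N = Module N
    open IsHom hom

    mono : ∀ {a b} → a M.≤ b → h a N.≤ h b
    mono = ⋁-preserving⇒mono M.isCLat N.isCLat h cong (λ f → proj₂ (pres-⋁ f))

    ∨-least : ∀ {a b c} → h a N.≤ c → h b N.≤ c → h (a M.∨ b) N.≤ c
    ∨-least ha≤c hb≤c = N.≤-trans (proj₁ (pres-⋁ _)) (N.⋁-least _ λ
      { (lift true) → ha≤c ; (lift false) → hb≤c })

  module _ (M : Module V) where
    open Module M

    record IsPrenucleus (j : Carrier → Carrier) : Set ℓ where
      field
        infl  : ∀ a → a ≤ j a
        mono  : ∀ {a b} → a ≤ b → j a ≤ j b
        *-sub : ∀ v a → (v * j a) ≤ j (v * a)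

    record IsNucleus (k : Carrier → Carrier) : Set ℓ where
      field
        isPrenucleus : IsPrenucleus k
        idem         : ∀ a → k (k a) ≈ k a
      open IsPrenucleus isPrenucleus public

    generated-isNucleus : ∀ {j} → IsPrenucleus j → IsNucleus (nucl L j)
    generated-isNucleus {j} isPrenucleus = record
      { isPrenucleus = record
        { infl  = nucl-infl isCLat j infl mono
        ; mono  = λ {a} {b} a≤b → nucl-below isCLat j infl mono a
            (nucl L j b , nucl-fix isCLat j infl mono b , ≤-trans a≤b (nucl-infl isCLat j infl mono b))
        ; *-sub = λ v → nucl-lax isCLat isCLat (v *_) (*-monoʳ v) (λ f → proj₁ (*-⋁ʳ v f))
                          infl mono infl mono (*-sub v)
        }
      ; idem = nucl-idem isCLat j infl mono
      }
      where
      open IsPrenucleus isPrenucleus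
      open ModuleProperties M

  module NucleusProperties {M : Module V} {k : Module.Carrier M → Module.Carrier M}
                           (nucleus : IsNucleus M k) where
    open Module M
    open ModuleProperties M
    open IsNucleus nucleus

    cong : ∀ {a b} → a ≈ b → k a ≈ k b
    cong (a≤b , b≤a) = mono a≤b , mono b≤a

    a≤kb⇒ka≤kb : ∀ {a b} → a ≤ k b → k a ≤ k b
    a≤kb⇒ka≤kb a≤kb = ≤-trans (mono a≤kb) (proj₁ (idem _))

    k-⋁ : ∀ {I : Set ℓ} (f : I → Carrier) → k (⋁ f) ≈ k (⋁ (k ∘ f))
    k-⋁ f = mono (⋁-least f (λ i → ≤-trans (infl (f i)) (⋁-ub (k ∘ f) i)))
          , a≤kb⇒ka≤kb (⋁-least (k ∘ f) (λ i → mono (⋁-ub f i)))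

    k-* : ∀ v a → k (v * a) ≈ k (v * k a)
    k-* v a = mono (*-monoʳ v (infl a)) , a≤kb⇒ka≤kb (*-sub v a)

  module _ {M : Module V} {k : Module.Carrier M → Module.Carrier M} (nucleus : IsNucleus M k) where
    open Module M
    open IsNucleus nucleus

    Fixed : RawModule V
    Fixed = record
      { L   = record
        { Carrier = Σ Carrier (λ m → k m ≈ m)
        ; _≤_     = λ m m′ → proj₁ m ≤ proj₁ m′
        ; ⋁       = λ f → k (⋁ (proj₁ ∘ f)) , idem _
        }
      ; _*_ = λ v m → k (v * proj₁ m) , idem _
      }

    Fixed-isModule : IsModule V Fixed
    Fixed-isModule = record
      { isCLat  = record
        { ≤-refl  = ≤-refl
        ; ≤-trans = ≤-trans
        ; ⋁-ub    = λ f i → ≤-trans (⋁-ub (proj₁ ∘ f) i) (infl _)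
        ; ⋁-least = λ f {(b , kb≈b)} fᵢ≤b →
            ≤-trans (mono (⋁-least (proj₁ ∘ f) fᵢ≤b)) (proj₁ kb≈b)
        }
      ; *-cong  = λ u≈v a≈b → cong (*-cong u≈v a≈b)
      ; *-⋁ˡ    = λ f (a , _) → begin-equality
          k (V.⋁ f * a)                 ≈⟨ cong (*-⋁ˡ f a) ⟩
          k (⋁ (λ i → f i * a))         ≈⟨ k-⋁ _ ⟩
          k (⋁ (λ i → k (f i * a)))     ∎
      ; *-⋁ʳ    = λ v f → begin-equality
          k (v * k (⋁ (proj₁ ∘ f)))            ≈⟨ k-* v _ ⟨
          k (v * ⋁ (proj₁ ∘ f))                ≈⟨ cong (*-⋁ʳ v _) ⟩
          k (⋁ (λ i → v * proj₁ (f i)))        ≈⟨ k-⋁ _ ⟩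
          k (⋁ (λ i → k (v * proj₁ (f i))))    ∎
      ; *-assoc = λ u v (a , _) → begin-equality
          k (u * k (v * a))             ≈⟨ k-* u _ ⟨
          k (u * (v * a))               ≈⟨ cong (*-assoc u v a) ⟩
          k ((u V.⊗ v) * a)             ∎
      ; *-unit  = λ (a , ka≈a) → Eq.trans (cong (*-unit a)) ka≈a
      }
      where
      open ModuleProperties M
      open NucleusProperties nucleus
      open PosetReasoning poset

  module FixedMap {M N : Module V} {k₁ : Module.Carrier M → Module.Carrier M}
           {k₂ : Module.Carrier N → Module.Carrier N}
           (nucleus₁ : IsNucleus M k₁) (nucleus₂ : IsNucleus N k₂)
           {h : Module.Carrier M → Module.Carrier N} (hom : IsHom V (Module.raw M) (Module.raw N) h)
           (h-k : ∀ a → Module._≤_ N (h (k₁ a)) (k₂ (h a))) where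
    private
      module M  = Module M
      module N  = Module N
      module k₁ = IsNucleus nucleus₁
      module k₂ = IsNucleus nucleus₂
    open IsHom hom using (pres-⋁; pres-*) renaming (cong to h-cong)
    open NucleusProperties nucleus₂ renaming (cong to k₂-cong)
    open HomProperties M N hom using () renaming (mono to h-mono)
    open ModuleProperties N
    open PosetReasoning poset

    k₂∘h∘k₁≈k₂∘h : ∀ a → k₂ (h (k₁ a)) N.≈ k₂ (h a)
    k₂∘h∘k₁≈k₂∘h a = a≤kb⇒ka≤kb (h-k a) , k₂.mono (h-mono (k₁.infl a))

    Fixed-map : RawModule.Carrier (Fixed nucleus₁) → RawModule.Carrier (Fixed nucleus₂)
    Fixed-map (m , _) = k₂ (h m) , k₂.idem _

    Fixed-map-isHom : IsHom V (Fixed nucleus₁) (Fixed nucleus₂) Fixed-map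
    Fixed-map-isHom = record
      { cong   = λ a≈b → k₂-cong (h-cong a≈b)
      ; pres-⋁ = λ f → begin-equality
          k₂ (h (k₁ (M.⋁ (proj₁ ∘ f))))            ≈⟨ k₂∘h∘k₁≈k₂∘h _ ⟩
          k₂ (h (M.⋁ (proj₁ ∘ f)))                 ≈⟨ k₂-cong (pres-⋁ _) ⟩
          k₂ (N.⋁ (λ i → h (proj₁ (f i))))         ≈⟨ k-⋁ _ ⟩
          k₂ (N.⋁ (λ i → k₂ (h (proj₁ (f i)))))    ∎
      ; pres-* = λ v (a , _) → begin-equality
          k₂ (h (k₁ (v M.* a)))                    ≈⟨ k₂∘h∘k₁≈k₂∘h _ ⟩
          k₂ (h (v M.* a))                         ≈⟨ k₂-cong (pres-* v a) ⟩
          k₂ (v N.* h a)                           ≈⟨ k-* v _ ⟩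
          k₂ (v N.* k₂ (h a))                      ∎
      }

  module _ (J : Frame V) where
    open Frame J

    module _ (A : Module V) where
      private
        module A = Module A
      open RawCLat (PowL J A) using () renaming (_≈_ to _≈ᵀ_; _≤_ to _≤ᵀ_)

      pointwise-≈ : ∀ {a b : T → A.Carrier} → (∀ t → a t A.≈ b t) → a ≈ᵀ b
      pointwise-≈ a≈b = (λ t → proj₁ (a≈b t)) , (λ t → proj₂ (a≈b t))

      ᵢ₌-mono : ∀ {x y} i → x A.≤ y → _ᵢ₌ J A x i ≤ᵀ _ᵢ₌ J A y i
      ᵢ₌-mono i x≤y t = A.⋁-least _ (λ t≡i → A.≤-trans x≤y (A.⋁-ub _ t≡i))

    PowModule : Module V → Module V
    PowModule A = record
      { raw      = PowRaw J A
      ; isModule = record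
        { isCLat  = Pow-isCLat J A
        ; *-cong  = λ u≈v a≈b → pointwise-≈ A (λ t → A.*-cong u≈v (proj₁ a≈b t , proj₂ a≈b t))
        ; *-⋁ˡ    = λ f a → pointwise-≈ A (λ t → A.*-⋁ˡ f (a t))
        ; *-⋁ʳ    = λ v f → pointwise-≈ A (λ t → A.*-⋁ʳ v (λ i → f i t))
        ; *-assoc = λ u v a → pointwise-≈ A (λ t → A.*-assoc u v (a t))
        ; *-unit  = λ a → pointwise-≈ A (λ t → A.*-unit (a t))
        }
      }
      where module A = Module A

    module _ (M N : Module V) {h : Module.Carrier M → Module.Carrier N}
             (hom : IsHom V (Module.raw M) (Module.raw N) h) where
      open IsHom hom
      open RawCLat (PowL J N) using () renaming (_≈_ to _≈ᵀ_)

      ∘-isHom : IsHom V (PowRaw J M) (PowRaw J N) (h ∘_)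
      ∘-isHom = record
        { cong   = λ a≈b → pointwise-≈ N (λ t → cong (proj₁ a≈b t , proj₂ a≈b t))
        ; pres-⋁ = λ f → pointwise-≈ N (λ t → pres-⋁ (λ i → f i t))
        ; pres-* = λ v a → pointwise-≈ N (λ t → pres-* v (a t))
        }

      ∘-ᵢᵣ : ∀ x i → (h ∘ _ᵢᵣ J M x i) ≈ᵀ _ᵢᵣ J N (h x) i
      ∘-ᵢᵣ x i = pointwise-≈ N (λ t → pres-* (r i t) x)

      ∘-ᵢ₌ : ∀ x i → (h ∘ _ᵢ₌ J M x i) ≈ᵀ _ᵢ₌ J N (h x) i
      ∘-ᵢ₌ x i = pointwise-≈ N (λ t → pres-⋁ (λ _ → x))

    scaling : (H : FSL V) → V.Carrier → Lax V H H
    scaling H v = record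
      { fun = v *_
      ; hom = record
        { cong   = *-cong (CLatProperties.Eq.refl V.isCLat)
        ; pres-⋁ = *-⋁ʳ v
        ; pres-* = λ u a → begin-equality
            v * (u * a)        ≈⟨ *-assoc v u a ⟩
            (v V.⊗ u) * a      ≈⟨ *-cong (V.⊗-comm v u) Eq.refl ⟩
            (u V.⊗ v) * a      ≈⟨ *-assoc u v a ⟨
            u * (v * a)        ∎
        }
      ; lax = λ a → proj₁ (IsHom.pres-* F-hom v a)
      }
      where
      open FSL H
      open CLatProperties isCLat
      open PosetReasoning poset

    module _ {H₁ H₂ : FSL V} (f : Lax V H₁ H₂) where
      private
        module H₁ = FSL H₁
        module H₂ = FSL H₂
        module f  = Lax f
        module P₁ = Module (PowModule H₁.A)
        module P₂ = Module (PowModule H₂.A)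
        fᵀ-isHom = ∘-isHom H₁.A H₂.A f.hom

        fᵀ-⋁ : ∀ {I : Set ℓ} (g : I → P₁.Carrier) →
               (f.fun ∘ P₁.⋁ g) P₂.≤ P₂.⋁ (λ i → f.fun ∘ g i)
        fᵀ-⋁ g = proj₁ (IsHom.pres-⋁ fᵀ-isHom g)
      open HomProperties (PowModule H₁.A) (PowModule H₂.A) fᵀ-isHom
        renaming (mono to fᵀ-mono; ∨-least to fᵀ-∨-least)
      open CLatProperties P₂.isCLat
      open PosetReasoning poset

      -- Laxness F₂ ∘ f ≤ f ∘ F₁ is what puts the image of a generating pair of [J, H₁]
      -- under a generating pair of [J, H₂].
      JH-lax : ∀ {a c d} → JH J H₁ c d ⊎ JH J H₁ d c → d P₁.≤ a →
               (f.fun ∘ c) P₂.≤ jJH J H₂ (f.fun ∘ a)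
      JH-lax {a} (inj₁ (x , i , refl , refl)) d≤a = fᵀ-∨-least
        (begin
          f.fun ∘ _ᵢᵣ J H₁.A x i    ≈⟨ ∘-ᵢᵣ H₁.A H₂.A f.hom x i ⟩
          _ᵢᵣ J H₂.A (f.fun x) i     ≤⟨ x≤x∨y _ _ ⟩
          _ᵢᵣ J H₂.A (f.fun x) i P₂.∨ _ᵢ₌ J H₂.A (H₂.F (f.fun x)) i
            ≤⟨ jRel-generator (inj₁ (f.fun x , i , refl , refl)) d′≤fa ⟩
          jJH J H₂ (f.fun ∘ a)       ∎)
        (P₂.≤-trans (fᵀ-mono d≤a) (jRel-infl P₂.isCLat (JH J H₂) _))
        where
        d′≤fa : _ᵢ₌ J H₂.A (H₂.F (f.fun x)) i P₂.≤ (f.fun ∘ a)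
        d′≤fa = begin
          _ᵢ₌ J H₂.A (H₂.F (f.fun x)) i   ≤⟨ ᵢ₌-mono H₂.A i (f.lax x) ⟩
          _ᵢ₌ J H₂.A (f.fun (H₁.F x)) i   ≈⟨ ∘-ᵢ₌ H₁.A H₂.A f.hom (H₁.F x) i ⟨
          f.fun ∘ _ᵢ₌ J H₁.A (H₁.F x) i   ≤⟨ fᵀ-mono d≤a ⟩
          f.fun ∘ a                        ∎
      JH-lax {a} (inj₂ (x , i , refl , refl)) d≤a = begin
        f.fun ∘ _ᵢ₌ J H₁.A (H₁.F x) i
          ≤⟨ fᵀ-mono (P₁.≤-trans (CLatProperties.y≤x∨y P₁.isCLat _ _) d≤a) ⟩
        f.fun ∘ a                        ≤⟨ jRel-infl P₂.isCLat (JH J H₂) _ ⟩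
        jJH J H₂ (f.fun ∘ a)             ∎

      jJH-lax : ∀ a → (f.fun ∘ jJH J H₁ a) P₂.≤ jJH J H₂ (f.fun ∘ a)
      jJH-lax = jRel-lax P₁.isCLat P₂.isCLat (f.fun ∘_) fᵀ-mono fᵀ-⋁ JH-lax

      nJH-lax : ∀ a → (f.fun ∘ nJH J H₁ a) P₂.≤ nJH J H₂ (f.fun ∘ a)
      nJH-lax = nucl-lax P₁.isCLat P₂.isCLat (f.fun ∘_) fᵀ-mono fᵀ-⋁
        (jRel-infl P₁.isCLat (JH J H₁)) (jRel-mono P₁.isCLat (JH J H₁))
        (jRel-infl P₂.isCLat (JH J H₂)) (jRel-mono P₂.isCLat (JH J H₂)) jJH-lax

    -- Scalar multiplication is itself a lax morphism, so jJH-lax yields the prenucleus condition.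
    jJH-isPrenucleus : (H : FSL V) → IsPrenucleus (PowModule (FSL.A H)) (jJH J H)
    jJH-isPrenucleus H = record
      { infl  = jRel-infl (Pow-isCLat J (FSL.A H)) (JH J H)
      ; mono  = jRel-mono (Pow-isCLat J (FSL.A H)) (JH J H)
      ; *-sub = λ v → jJH-lax (scaling H v)
      }

    nJH-isNucleus : (H : FSL V) → IsNucleus (PowModule (FSL.A H)) (nJH J H)
    nJH-isNucleus H = generated-isNucleus (PowModule (FSL.A H)) (jJH-isPrenucleus H)

    Tensor-isModule : (H : FSL V) → IsModule V (Tensor J H)
    Tensor-isModule H = Fixed-isModule (nJH-isNucleus H)

    module _ {H₁ H₂ : FSL V} (f : Lax V H₁ H₂) where
      open FixedMap (nJH-isNucleus H₁) (nJH-isNucleus H₂)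
                    (∘-isHom (FSL.A H₁) (FSL.A H₂) (Lax.hom f)) (nJH-lax f)
      open CLatProperties (Module.isCLat (PowModule (FSL.A H₂)))

      tensorMap : Fix J H₁ → Fix J H₂
      tensorMap = Fixed-map

      tensorMap-Char : Char J H₁ H₂ (Lax.fun f) tensorMap
      tensorMap-Char = Fixed-map-isHom , λ x → Eq.sym (k₂∘h∘k₁≈k₂∘h x)

    module _ {H₁ H₂ : FSL V} where
      open RawModule (Tensor J H₂) using (_≈_)
      open CLatProperties (IsModule.isCLat (Tensor-isModule H₂))
      open PosetReasoning poset

      Char⇒≈nMap : ∀ {φ g} → Char J H₁ H₂ φ g → ∀ a → g a ≈ nMap J H₂ (φ ∘ proj₁ a)
      Char⇒≈nMap {φ} {g} (g-isHom , g-nMap) (m , nm≈m) = begin-equality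
        g (m , nm≈m)       ≈⟨ IsHom.cong g-isHom (swap nm≈m) ⟩
        g (nMap J H₁ m)    ≈⟨ g-nMap m ⟨
        nMap J H₂ (φ ∘ m)  ∎

    Char-id : ∀ {H g} → Char J H H (λ a → a) g → ∀ a → RawModule._≈_ (Tensor J H) (g a) a
    Char-id {H} {g} g-Char a = begin-equality
      g a                   ≈⟨ Char⇒≈nMap {H} {H} {λ a → a} g-Char a ⟩
      nMap J H (proj₁ a)    ≈⟨ proj₂ a ⟩
      a                     ∎
      where
      open CLatProperties (IsModule.isCLat (Tensor-isModule H))
      open PosetReasoning poset

    Char-∘ : ∀ {H₁ H₂ H₃ φ ψ g₁ g₂ g₃} →
      Char J H₁ H₂ φ g₁ → Char J H₂ H₃ ψ g₂ → Char J H₁ H₃ (ψ ∘ φ) g₃ →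
      ∀ a → RawModule._≈_ (Tensor J H₃) (g₃ a) (g₂ (g₁ a))
    Char-∘ {H₁} {H₂} {H₃} {φ} {ψ} {g₁} {g₂} {g₃} g₁-Char (g₂-isHom , g₂-nMap) g₃-Char a =
      begin-equality
      g₃ a                              ≈⟨ Char⇒≈nMap {H₁} {H₃} {ψ ∘ φ} g₃-Char a ⟩
      nMap J H₃ (ψ ∘ φ ∘ proj₁ a)       ≈⟨ g₂-nMap (φ ∘ proj₁ a) ⟩
      g₂ (nMap J H₂ (φ ∘ proj₁ a))
        ≈⟨ IsHom.cong g₂-isHom (Char⇒≈nMap {H₁} {H₂} {φ} g₁-Char a) ⟨
      g₂ (g₁ a)                         ∎
      where
      open CLatProperties (IsModule.isCLat (Tensor-isModule H₃))
      open PosetReasoning poset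

mainTheorem8 : {ℓ : Level} (V : Quantale ℓ) (J : Frame V) →
    -- J ⊗ H is a V-module (object part of the functor)
    ((H : FSL V) → IsModule V (Tensor J H))
    -- existence and uniqueness of J ⊗ f for every lax morphism f
    × ((H₁ H₂ : FSL V) (f : Lax V H₁ H₂) →
        Σ (Fix J H₁ → Fix J H₂) (λ g →
          Char J H₁ H₂ (Lax.fun f) g
          × ((g' : Fix J H₁ → Fix J H₂) → Char J H₁ H₂ (Lax.fun f) g' →
              (a : Fix J H₁) → RawModule._≈_ (Tensor J H₂) (g' a) (g a))))
    -- J ⊗ id = id
    × ((H : FSL V) (g : Fix J H → Fix J H) → Char J H H (λ a → a) g →
        (a : Fix J H) → RawModule._≈_ (Tensor J H) (g a) a)
    -- J ⊗ (f' ∘ f) = (J ⊗ f') ∘ (J ⊗ f)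
    × ((H₁ H₂ H₃ : FSL V) (f : Lax V H₁ H₂) (f' : Lax V H₂ H₃)
        (g₁ : Fix J H₁ → Fix J H₂) (g₂ : Fix J H₂ → Fix J H₃)
        (g₃ : Fix J H₁ → Fix J H₃) →
        Char J H₁ H₂ (Lax.fun f) g₁ → Char J H₂ H₃ (Lax.fun f') g₂ →
        Char J H₁ H₃ (λ a → Lax.fun f' (Lax.fun f a)) g₃ →
        (a : Fix J H₁) → RawModule._≈_ (Tensor J H₃) (g₃ a) (g₂ (g₁ a)))
mainTheorem8 V J =
    Tensor-isModule J
  , (λ H₁ H₂ f → tensorMap J f , tensorMap-Char J f , λ _ → Char⇒≈nMap J {H₁} {H₂} {Lax.fun f})
  , (λ H g → Char-id J {H})
  , (λ H₁ H₂ H₃ f f′ g₁ g₂ g₃ → Char-∘ J {H₁} {H₂} {H₃} {Lax.fun f} {Lax.fun f′})
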